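{- Let $t$ be an eligible tenacity and assume $B(w)$ is a singleton for every vertex $w$ with $t_m\le\mathrm{t}(w)\le t$. Then the set of blossoms of tenacity at most $t$ forms a laminar family, i.e., any two such blossoms are either disjoint or one is contained in the other.
   Context: $G=(V,E)$ is a finite undirected graph with matching $M$; alternating paths alternate matched/unmatched edges; $l_m$ is the minimum length of an alternating path between two distinct unmatched vertices ($\infty$ if none). $\mathrm{evenlevel}(v)$ ($\mathrm{oddlevel}(v)$) is the length of a minimum even (odd) length alternating path from some unmatched vertex to $v$ ($\infty$ if none). $v$ is outer if $\mathrm{evenlevel}(v)<\mathrm{oddlevel}(v)$. Tenacity $\mathrm{t}(v)=\mathrm{evenlevel}(v)+\mathrm{oddlevel}(v)$; $t_m$ is the minimum tenacity; odd $t$ with $t_m\le t<l_m$ is eligible. For $v$ of eligible tenacity $t$ and $p$ an evenlevel$(v)$ or oddlevel$(v)$ path starting at unmatched $f$, $F(p,v)$ is the vertex of tenacity $>t$ on $p$ farthest from $f$; $B(v)$ is the set of all $F(p,v)$; if singleton, its element is $\mathrm{base}(v)$. Blossoms: for outer $b$ and odd $t'\le t$ with $\mathrm{t}(b)>t'$: $\mathcal{B}_{b,1}=\emptyset$, $S_{b,t'}=\{v:\mathrm{t}(v)=t',\mathrm{base}(v)=b\}$, $\mathcal{B}_{b,t'}=S_{b,t'}\cup\bigcup_{w\in S_{b,t'}\cup\{b\},\,w\text{ outer}}\mathcal{B}_{w,t'-2}$; this is the blossom of tenacity $t'$ and base $b$. -}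

module Defs where

open import Data.Nat using (ℕ; zero; suc; _+_; _*_; _≤_; _<_)
open import Data.Nat.Divisibility using (_∣_)
open import Data.Fin using (Fin)
open import Data.Maybe using (Maybe; just; nothing)
open import Data.List using (List; []; _∷_; _++_; length)
open import Data.List.Relation.Unary.All using (All)
open import Data.List.Relation.Unary.Unique.Propositional using (Unique)
open import Data.Product using (Σ; ∃; ∃₂; _×_; _,_)
open import Data.Sum using (_⊎_)
open import Data.Empty using (⊥)
open import Data.Unit using (⊤)
open import Data.Bool using (Bool; true; false; not)
open import Relation.Nullary using (¬_)
open import Relation.Binary.PropositionalEquality using (_≡_; _≢_)

-- Natural numbers extended with ∞ (nothing = ∞)

ℕ∞ : Set
ℕ∞ = Maybe ℕ

_+∞_ : ℕ∞ → ℕ∞ → ℕ∞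
just a  +∞ just b  = just (a + b)
just _  +∞ nothing = nothing
nothing +∞ _       = nothing

_<∞_ : ℕ∞ → ℕ∞ → Set
just a  <∞ just b  = a < b
just _  <∞ nothing = ⊤
nothing <∞ _       = ⊥

_>∞_ : ℕ∞ → ℕ → Set
nothing >∞ t = ⊤
just a  >∞ t = t < a

_≤∞_ : ℕ∞ → ℕ → Set
nothing ≤∞ t = ⊥
just a  ≤∞ t = a ≤ t

Least : (ℕ → Set) → ℕ∞ → Set
Least P (just k) = P k × (∀ j → P j → k ≤ j)
Least P nothing  = ∀ j → ¬ P j

Even Odd : ℕ → Set
Even k = 2 ∣ k
Odd  k = ¬ (2 ∣ k)

record Graph (n : ℕ) : Set₁ where
  field
    Adj    : Fin n → Fin n → Set
    sym    : ∀ {u v} → Adj u v → Adj v u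
    irrefl : ∀ {u} → ¬ Adj u u

record Matching {n : ℕ} (G : Graph n) : Set₁ where
  open Graph G
  field
    Mt     : Fin n → Fin n → Set
    ⊆E     : ∀ {u v} → Mt u v → Adj u v
    sym    : ∀ {u v} → Mt u v → Mt v u
    unique : ∀ {u v w} → Mt u v → Mt u w → v ≡ w

module _ {n : ℕ} (G : Graph n) (M : Matching G) where
  open Graph G using (Adj)
  open Matching M using (Mt)

  Unmatched : Fin n → Set
  Unmatched f = ∀ v → ¬ Mt f v

  EdgeKind : Bool → Fin n → Fin n → Set
  EdgeKind true  u w = Mt u w
  EdgeKind false u w = ¬ Mt u w

  AltFrom : Bool → Fin n → List (Fin n) → Set
  AltFrom b u []       = ⊤
  AltFrom b u (w ∷ ws) = Adj u w × EdgeKind b u w × AltFrom (not b) w ws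

  end : Fin n → List (Fin n) → Fin n
  end u []       = u
  end u (w ∷ ws) = end w ws

  -- the path  f ∷ rest  is an alternating (simple) path from f to v;
  -- its length (number of edges) is  length rest
  AltPath : Fin n → List (Fin n) → Fin n → Set
  AltPath f rest v =
    Unique (f ∷ rest) × end f rest ≡ v × Σ Bool (λ b → AltFrom b f rest)

  ReachLen : Fin n → ℕ → Set
  ReachLen v k = ∃ λ f → Unmatched f × ∃ λ rest → AltPath f rest v × length rest ≡ k

  IsEvenLevel : Fin n → ℕ∞ → Set
  IsEvenLevel v = Least (λ k → Even k × ReachLen v k)

  IsOddLevel : Fin n → ℕ∞ → Set
  IsOddLevel v = Least (λ k → Odd k × ReachLen v k)

  IsLm : ℕ∞ → Set
  IsLm = Least (λ k → ∃₂ λ f g → Unmatched f × Unmatched g × f ≢ g ×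
                        ∃ λ rest → AltPath f rest g × length rest ≡ k)

  module _ (el ol : Fin n → ℕ∞) where

    ten : Fin n → ℕ∞
    ten v = el v +∞ ol v

    Outer : Fin n → Set
    Outer v = el v <∞ ol v

    IsTm : ℕ∞ → Set
    IsTm = Least (λ k → ∃ λ v → ten v ≡ just k)

    LevelPath : Fin n → Fin n → List (Fin n) → Set
    LevelPath v f rest = Unmatched f × AltPath f rest v ×
      (el v ≡ just (length rest) ⊎ ol v ≡ just (length rest))

    IsF : ℕ → Fin n → List (Fin n) → Fin n → Set
    IsF t f rest x = ∃₂ λ pre post → f ∷ rest ≡ pre ++ (x ∷ post) ×
      ten x >∞ t × All (λ y → ¬ (ten y >∞ t)) post

    InB : Fin n → Fin n → Set
    InB v x = ∃ λ t → ten v ≡ just t ×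
      ∃₂ λ f rest → LevelPath v f rest × IsF t f rest x

    BaseIs : Fin n → Fin n → Set
    BaseIs v b = ∀ x → (InB v x → x ≡ b) × (x ≡ b → InB v x)

    InS : Fin n → ℕ → Fin n → Set
    InS b t' v = ten v ≡ just t' × BaseIs v b

    -- InBlossom b k x  :  x ∈ 𝓑_{b, 2k+1}
    InBlossom : Fin n → ℕ → Fin n → Set
    InBlossom b zero    x = ⊥
    InBlossom b (suc k) x =
      InS b (suc (suc (suc (2 * k)))) x ⊎
      ∃ λ w → (InS b (suc (suc (suc (2 * k)))) w ⊎ w ≡ b) ×
              Outer w × InBlossom w k x

    BlossomIdx : ℕ → Fin n → ℕ → Set
    BlossomIdx t b k = Outer b × suc (2 * k) ≤ t × ten b >∞ suc (2 * k)

    Eligible : ℕ∞ → ℕ∞ → ℕ → Set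
    Eligible lm tm t = Odd t × tm ≤∞ t × lm >∞ t

-- Blossom membership is built by following bases: x ∈ 𝓑_{b,2k+1} means that
-- the chain x, base(x), base(base(x)), … reaches b through vertices of
-- tenacity below that of b.  Since a vertex has at most one base, a common
-- element of two blossoms puts both bases on one chain, so b₁ = b₂,
-- b₁ ∈ 𝓑₂ or b₂ ∈ 𝓑₁.  An outer member w of a blossom with t(w) > 2j+1 brings
-- its whole blossom 𝓑_{w,2j+1} along, which turns meeting into containment.  Existence of bases also makes
-- membership decidable, which is what lets "disjoint or not" be decided.
module Submission where

open import Defs
open import Data.Nat using (ℕ; zero; suc; _*_; _≤_; _<_; _≤′_; ≤′-reflexive; ≤′-step; _≟_; _<?_; _≤?_; s≤s⁻¹; s<s⁻¹)
open import Data.Nat.Properties using (*-suc; *-cancelˡ-<; m+n≤o⇒n≤o; ≤⇒≤′; ≰⇒≥)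
open import Data.Fin using (Fin) renaming (_≟_ to _≟ᶠ_)
open import Data.Fin.Properties using (any?)
open import Data.Maybe using (just; nothing)
open import Data.Maybe.Properties using (≡-dec)
open import Data.Product using (∃; _×_; _,_; proj₁; proj₂)
open import Data.Sum using (_⊎_; inj₁; inj₂; map₂)
open import Data.Unit using (tt)
open import Function using (_∘_)
open import Relation.Nullary using (¬_; Dec; yes; no)
open import Relation.Nullary.Decidable using (_×-dec_; _⊎-dec_)
open import Relation.Unary using (_∈_; _⊆_; _⊆′_; _∩_; Empty; Satisfiable)
open import Relation.Binary.PropositionalEquality using (_≡_; refl; sym; subst)

odd-<-odd⇒≤ : ∀ j k → suc (2 * j) < suc (suc (suc (2 * k))) → j ≤ k
odd-<-odd⇒≤ j k lt =
  s≤s⁻¹ (*-cancelˡ-< 2 j (suc k) (subst (2 * j <_) (sym (*-suc 2 k)) (s<s⁻¹ lt)))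

module Blossoms {n : ℕ} (G : Graph n) (M : Matching G) (el ol : Fin n → ℕ∞) where

  𝓑 : Fin n → ℕ → Fin n → Set
  𝓑 = InBlossom G M el ol

  IsTm⇒≤ten : ∀ {tm} → IsTm G M el ol tm → ∀ v s → ten G M el ol v ≡ just s → tm ≤∞ s
  IsTm⇒≤ten {just m}  (_ , least) v s eq = least s (v , eq)
  IsTm⇒≤ten {nothing} none        v s eq = none s (v , eq)

  BaseIs-unique : ∀ {v b c} → BaseIs G M el ol v b → BaseIs G M el ol v c → b ≡ c
  BaseIs-unique {b = b} vb vc = proj₁ (vc b) (proj₂ (vb b) refl)

  InBlossom-step : ∀ {b k} → Outer G M el ol b → 𝓑 b k ⊆ 𝓑 b (suc k)
  InBlossom-step {b} ob x∈ = inj₂ (b , inj₂ refl , ob , x∈)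

  InBlossom-mono : ∀ {b j k} → Outer G M el ol b → j ≤ k → 𝓑 b j ⊆ 𝓑 b k
  InBlossom-mono ob le = go (≤⇒≤′ le)
    where
    go : ∀ {j k} → j ≤′ k → 𝓑 _ j ⊆ 𝓑 _ k
    go (≤′-reflexive refl) = λ x∈ → x∈
    go (≤′-step le′)       = InBlossom-step ob ∘ go le′

  InBlossom-trans : ∀ {b k w j} → Outer G M el ol w → ten G M el ol w >∞ suc (2 * j) →
    w ∈ 𝓑 b k → 𝓑 w j ⊆ 𝓑 b k
  InBlossom-trans {k = suc k} {j = j} ow tw (inj₁ w∈S@(tw≡ , _)) x∈ =
    inj₂ (_ , inj₁ w∈S , ow , InBlossom-mono ow (odd-<-odd⇒≤ j k (subst (_>∞ _) tw≡ tw)) x∈)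
  InBlossom-trans {k = suc k} ow tw (inj₂ (w′ , c , ow′ , w∈)) x∈ =
    inj₂ (w′ , c , ow′ , InBlossom-trans ow tw w∈ x∈)

  InBlossom-base : ∀ {b k w c} → w ∈ 𝓑 b k → BaseIs G M el ol w c → c ≡ b ⊎ c ∈ 𝓑 b k
  InBlossom-base {k = suc k} (inj₁ (_ , wb)) wc = inj₁ (BaseIs-unique wc wb)
  InBlossom-base {k = suc k} (inj₂ (w′ , inj₂ refl , ow′ , w∈)) wc with InBlossom-base w∈ wc
  ... | inj₁ c≡b = inj₁ c≡b
  ... | inj₂ c∈  = inj₂ (InBlossom-step ow′ c∈)
  InBlossom-base {k = suc k} (inj₂ (w′ , inj₁ w′∈S , ow′ , w∈)) wc with InBlossom-base w∈ wc
  ... | inj₁ refl = inj₂ (inj₁ w′∈S)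
  ... | inj₂ c∈   = inj₂ (inj₂ (w′ , inj₁ w′∈S , ow′ , c∈))

  InBlossom-meet : ∀ {b₁ k₁ b₂ k₂ x} → x ∈ 𝓑 b₁ k₁ → x ∈ 𝓑 b₂ k₂ →
    b₁ ≡ b₂ ⊎ b₁ ∈ 𝓑 b₂ k₂ ⊎ b₂ ∈ 𝓑 b₁ k₁
  InBlossom-meet {k₁ = suc k₁} (inj₁ (_ , xb₁)) x∈₂ = map₂ inj₁ (InBlossom-base x∈₂ xb₁)
  InBlossom-meet {k₁ = suc k₁} (inj₂ (_ , inj₂ refl , ob₁ , x∈₁)) x∈₂ with InBlossom-meet x∈₁ x∈₂
  ... | inj₁ b₁≡b₂      = inj₁ b₁≡b₂
  ... | inj₂ (inj₁ b₁∈) = inj₂ (inj₁ b₁∈)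
  ... | inj₂ (inj₂ b₂∈) = inj₂ (inj₂ (InBlossom-step ob₁ b₂∈))
  InBlossom-meet {k₁ = suc k₁} (inj₂ (w , inj₁ w∈S@(_ , wb₁) , ow , x∈₁)) x∈₂
    with InBlossom-meet x∈₁ x∈₂
  ... | inj₁ refl       = inj₂ (inj₂ (inj₁ w∈S))
  ... | inj₂ (inj₂ b₂∈) = inj₂ (inj₂ (inj₂ (w , inj₁ w∈S , ow , b₂∈)))
  ... | inj₂ (inj₁ w∈₂) = map₂ inj₁ (InBlossom-base w∈₂ wb₁)

  blossoms-laminar : ∀ {b₁ k₁ b₂ k₂} →
    Outer G M el ol b₁ → ten G M el ol b₁ >∞ suc (2 * k₁) →
    Outer G M el ol b₂ → ten G M el ol b₂ >∞ suc (2 * k₂) →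
    Dec (Satisfiable (𝓑 b₁ k₁ ∩ 𝓑 b₂ k₂)) →
    Empty (𝓑 b₁ k₁ ∩ 𝓑 b₂ k₂) ⊎ 𝓑 b₁ k₁ ⊆′ 𝓑 b₂ k₂ ⊎ 𝓑 b₂ k₂ ⊆′ 𝓑 b₁ k₁
  blossoms-laminar _ _ _ _ (no disjoint) = inj₁ λ x x∈ → disjoint (x , x∈)
  blossoms-laminar {k₁ = k₁} {k₂ = k₂} ob₁ tb₁ ob₂ tb₂ (yes (_ , x∈₁ , x∈₂))
    with InBlossom-meet x∈₁ x∈₂
  ... | inj₂ (inj₁ b₁∈) = inj₂ (inj₁ λ _ → InBlossom-trans ob₁ tb₁ b₁∈)
  ... | inj₂ (inj₂ b₂∈) = inj₂ (inj₂ λ _ → InBlossom-trans ob₂ tb₂ b₂∈)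
  ... | inj₁ refl with k₁ ≤? k₂
  ...   | yes k₁≤k₂ = inj₂ (inj₁ λ _ → InBlossom-mono ob₁ k₁≤k₂)
  ...   | no  k₁≰k₂ = inj₂ (inj₂ λ _ → InBlossom-mono ob₁ (≰⇒≥ k₁≰k₂))

  <∞-dec : ∀ a b → Dec (a <∞ b)
  <∞-dec (just a) (just b) = a <? b
  <∞-dec (just _) nothing  = yes tt
  <∞-dec nothing  _        = no λ ()

  module _ (t : ℕ)
    (bases : ∀ w s → ten G M el ol w ≡ just s → s ≤ t → ∃ (BaseIs G M el ol w)) where

    InS-dec : ∀ s → s ≤ t → ∀ b x → Dec (InS G M el ol b s x)
    InS-dec s s≤t b x with ≡-dec _≟_ (ten G M el ol x) (just s)
    ... | no  tx≢s = no (tx≢s ∘ proj₁)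
    ... | yes tx≡s with bases x s tx≡s s≤t
    ...   | c , xc with b ≟ᶠ c
    ...     | yes refl = yes (tx≡s , xc)
    ...     | no  b≢c  = no λ (_ , xb) → b≢c (BaseIs-unique xb xc)

    InBlossom-dec : ∀ k → suc (2 * k) ≤ t → ∀ b x → Dec (x ∈ 𝓑 b k)
    InBlossom-dec zero    _ b x = no λ ()
    InBlossom-dec (suc k) p b x =
      InS-dec _ p′ b x ⊎-dec
      any? (λ w → (InS-dec _ p′ b w ⊎-dec w ≟ᶠ b) ×-dec <∞-dec (el w) (ol w) ×-dec
                  InBlossom-dec k (m+n≤o⇒n≤o 2 p′) w x)
      where
      p′ : suc (suc (suc (2 * k))) ≤ t
      p′ = subst (λ m → suc m ≤ t) (*-suc 2 k) p

proposition7p5 : ∀ {n} (G : Graph n) (M : Matching G)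
    (el ol : Fin n → ℕ∞) (lm tm : ℕ∞) →
    (∀ v → IsEvenLevel G M v (el v)) →
    (∀ v → IsOddLevel G M v (ol v)) →
    IsLm G M lm →
    IsTm G M el ol tm →
    (t : ℕ) → Eligible G M el ol lm tm t →
    (∀ w s → ten G M el ol w ≡ just s → tm ≤∞ s → s ≤ t →
      ∃ λ b → BaseIs G M el ol w b) →
    ∀ b₁ k₁ b₂ k₂ →
    BlossomIdx G M el ol t b₁ k₁ →
    BlossomIdx G M el ol t b₂ k₂ →
    (∀ x → ¬ (InBlossom G M el ol b₁ k₁ x × InBlossom G M el ol b₂ k₂ x)) ⊎
    (∀ x → InBlossom G M el ol b₁ k₁ x → InBlossom G M el ol b₂ k₂ x) ⊎
    (∀ x → InBlossom G M el ol b₂ k₂ x → InBlossom G M el ol b₁ k₁ x)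
proposition7p5 G M el ol lm tm _ _ _ isTm t _ singletonB b₁ k₁ b₂ k₂
  (ob₁ , k₁≤t , tb₁) (ob₂ , k₂≤t , tb₂) =
  blossoms-laminar ob₁ tb₁ ob₂ tb₂ (any? λ x → 𝓑? k₁ k₁≤t b₁ x ×-dec 𝓑? k₂ k₂≤t b₂ x)
  where
  open Blossoms G M el ol

  bases : ∀ w s → ten G M el ol w ≡ just s → s ≤ t → ∃ (BaseIs G M el ol w)
  bases w s tw≡s = singletonB w s tw≡s (IsTm⇒≤ten isTm w s tw≡s)

  𝓑? : ∀ k → suc (2 * k) ≤ t → ∀ b x → Dec (x ∈ 𝓑 b k)
  𝓑? = InBlossom-dec t bases
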